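{- Let $v\equiv 1\pmod 4$ with $\gcd(v,45)=1$. If there exists a PS$(v)$, then there exists a maximum $(45v,5,1)$-OOC.
   Context: PS$(v)$ ($v\equiv1\pmod4$): a set $\mathcal S$ of $(v-1)/4$ unordered pairs from $\mathbb{Z}_v$ with $\bigcup_{\{x,y\}\in\mathcal S}\pm\{x,y\}=\mathbb{Z}_v\setminus\{0\}$ and $\bigcup_{\{x,y\}\in\mathcal S}\pm\{x-y,x+y\}=\mathbb{Z}_v\setminus\{0\}$. A $(n,k,1)$-OOC is a set $\mathcal B$ of $k$-subsets of $\mathbb{Z}_n$ such that the multiset $\bigcup_{B\in\mathcal B}[x-y:x,y\in B,x\ne y]$ has no repeated elements; it is maximum if the set of elements of $\mathbb{Z}_n$ not in this multiset has size at most $k(k-1)$. -}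

module Defs where

open import Data.Nat using (ℕ; zero; suc; _+_; _*_; _∸_; _≤_; _/_; _%_)
open import Data.Nat.DivMod using (m%n<n)
open import Data.Fin using (Fin; toℕ; fromℕ<; _≟_)
open import Data.List using (List; []; _∷_; map; concatMap; filter; length; allFin; _++_)
open import Data.List.Relation.Unary.Unique.Propositional using (Unique)
open import Data.List.Membership.Propositional using (_∈_)
import Data.List.Membership.DecPropositional as DecMem
open import Data.Product using (_×_; _,_)
open import Relation.Binary.PropositionalEquality using (_≡_; _≢_)
open import Relation.Nullary using (¬?)
open import Function.Bundles using (_⇔_)

infixl 6 _+ₘ_ _-ₘ_

_+ₘ_ : {n : ℕ} → Fin n → Fin n → Fin n
_+ₘ_ {suc m} x y = fromℕ< (m%n<n (toℕ x + toℕ y) (suc m))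

-ₘ_ : {n : ℕ} → Fin n → Fin n
-ₘ_ {suc m} x = fromℕ< (m%n<n (suc m ∸ toℕ x) (suc m))

_-ₘ_ : {n : ℕ} → Fin n → Fin n → Fin n
x -ₘ y = x +ₘ (-ₘ y)

±pair : {n : ℕ} → Fin n × Fin n → List (Fin n)
±pair (x , y) = x ∷ -ₘ x ∷ y ∷ -ₘ y ∷ []

±diffsum : {n : ℕ} → Fin n × Fin n → List (Fin n)
±diffsum (x , y) = ±pair (x -ₘ y , x +ₘ y)

-- A PS(v): a collection S of (v-1)/4 unordered pairs {x,y} (each pair given
-- by one of its orderings) from ℤ_v such that
--   ⋃ ±{x,y} = ℤ_v ∖ {0}   and   ⋃ ±{x-y,x+y} = ℤ_v ∖ {0}.
record PS (v : ℕ) : Set where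
  field
    pairs     : List (Fin v × Fin v)
    size      : length pairs ≡ (v ∸ 1) / 4
    cover₁    : (z : Fin v) → (z ∈ concatMap ±pair pairs) ⇔ (toℕ z ≢ 0)
    cover₂    : (z : Fin v) → (z ∈ concatMap ±diffsum pairs) ⇔ (toℕ z ≢ 0)

diffs : {n : ℕ} → List (Fin n) → List (Fin n)
diffs B = concatMap (λ x → map (λ y → x -ₘ y) (filter (λ y → ¬? (x ≟ y)) B)) B

IsKSubset : {n : ℕ} → ℕ → List (Fin n) → Set
IsKSubset k B = Unique B × length B ≡ k

allDiffs : {n : ℕ} → List (List (Fin n)) → List (Fin n)
allDiffs = concatMap diffs

record OOC (n k : ℕ) : Set where
  field
    blocks    : List (List (Fin n))
    distinct  : Unique blocks
    ksubsets  : (B : List (Fin n)) → B ∈ blocks → IsKSubset k B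
    noRepeat  : Unique (allDiffs blocks)

missing : {n k : ℕ} → OOC n k → List (Fin n)
missing {n} C = filter (λ z → ¬? (z ∈? allDiffs (OOC.blocks C))) (allFin n)
  where open DecMem (_≟_ {n}) using (_∈?_)

IsMaximum : {n k : ℕ} → OOC n k → Set
IsMaximum {k = k} C = length (missing C) ≤ k * (k ∸ 1)

-- Write ℤ_{45v} as ℤ₄₅ × ℤ_v (Chinese remainder theorem). Every pair {x,y} of the PS(v) is developed
-- into nine blocks whose ℤ_v-coordinates are 0, ±x, ±y, and two further blocks lie in ℤ₄₅ × {0}. A finite
-- computation in ℤ₄₅ shows that a difference of a pair block in class c ∈ ℤ₄₅ has ℤ_v-part m·e, where
-- m ∈ {1,2} and the orbit ±{x,y} or ±{x−y,x+y} containing e depend only on c, and that c together with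
-- the position of e in its orbit determines the block and the two points. The PS conditions and a count
-- show that the orbits of each kind partition ℤ_v ∖ {0}, and m is invertible because v is odd, so all
-- 20(9(v−1)/4 + 2) differences are distinct; they miss exactly 5 of the 45v residues.

module Submission where

open import Data.Empty using (⊥; ⊥-elim)
open import Data.Fin as Fin using (Fin; zero; suc; toℕ; fromℕ<; #_; _≟_)
import Data.Fin.Properties as Finₚ
open import Data.Integer as ℤ using (ℤ; +_; +[1+_]; -[1+_]; 0ℤ; 1ℤ)
import Data.Integer.Properties as ℤₚ
open import Data.Integer.Tactic.RingSolver using (solve-∀)
open import Data.List as List
  using (List; []; _∷_; _++_; length; filter; concat; concatMap; map; tabulate; allFin; cartesianProduct)
open import Data.List.Membership.Propositional using (_∈_)
open import Data.List.Membership.Propositional.Properties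
  using (∈-++⁻; ∈-map⁺; ∈-map⁻; ∈-concat⁺′; ∈-concat⁻′; ∈-filter⁺; ∈-filter⁻; ∈-tabulate⁺; ∈-tabulate⁻;
         ∈-allFin; ∈-cartesianProduct⁻)
import Data.List.Membership.DecPropositional as DecMembership
import Data.List.Properties as Listₚ
open import Data.List.Relation.Binary.Disjoint.Propositional using (Disjoint)
import Data.List.Relation.Binary.Disjoint.Propositional.Properties as Disjointₚ
open import Data.List.Relation.Binary.Subset.Propositional using (_⊆_)
open import Data.List.Relation.Unary.All as All using (All; []; _∷_)
import Data.List.Relation.Unary.All.Properties as Allₚ
open import Data.List.Relation.Unary.AllPairs as AllPairs using (AllPairs; []; _∷_)
import Data.List.Relation.Unary.AllPairs.Properties as AllPairsₚ
open import Data.List.Relation.Unary.Any as Any using (here; there)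
open import Data.List.Relation.Unary.Unique.Propositional using (Unique)
import Data.List.Relation.Unary.Unique.Propositional.Properties as Uniqueₚ
open import Data.Nat as ℕ using (ℕ; zero; suc; _≤_; NonZero)
open import Data.Nat.Coprimality as Coprimality using (Coprime; coprime-Bézout; 1-coprimeTo; gcd≡1⇒coprime)
open import Data.Nat.Divisibility using (_∣_; divides; ∣-trans; n∣m*n; ∣m+n∣m⇒∣n; ∣1⇒≡1)
open import Data.Nat.DivMod using (m≡m%n+[m/n]*n; m%n<n; m*n/n≡m)
open import Data.Nat.GCD using (gcd; module Bézout)
import Data.Nat.Properties as ℕₚ
open import Data.Nat.Tactic.RingSolver using () renaming (solve-∀ to ℕ-solve-∀)
open import Data.Product using (Σ; ∃; ∃₂; _×_; _,_; proj₁; proj₂)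
open import Data.Product.Properties using (≡-dec)
open import Data.Sum using (_⊎_; inj₁; inj₂; [_,_]′)
import Data.Sum.Properties as Sumₚ
open import Data.Vec using (Vec; []; _∷_; lookup)
open import Function using (_∘_; id; flip)
open import Function.Bundles using (Equivalence)
open import Level using (Level)
open import Relation.Binary.Bundles using (Setoid)
open import Relation.Binary.Core using (Rel)
open import Relation.Binary.Definitions using (DecidableEquality; Symmetric)
open import Relation.Binary.PropositionalEquality
  using (_≡_; _≢_; refl; sym; trans; cong; cong₂; subst; module ≡-Reasoning)
open import Relation.Binary.Structures using (IsEquivalence)
open import Relation.Nullary using (Dec; yes; no; ¬?; contradiction)
open import Relation.Nullary.Decidable using (_×-dec_; _⊎-dec_; toWitness)

open import Defs

module ModularArithmetic where

  open import Data.Integer using (_+_; _*_; -_; _-_; _⊖_)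

  infix 4 _≡_mod_

  record _≡_mod_ (a b : ℤ) (n : ℕ) : Set where
    constructor mod-by
    field
      quotient : ℤ
      equation : a ≡ b + quotient * + n

  module _ {n : ℕ} where

    ≡⇒≡-mod : ∀ {a b} → a ≡ b → a ≡ b mod n
    ≡⇒≡-mod {a} refl = mod-by 0ℤ (identity a (+ n))
      where identity : ∀ a n → a ≡ a + 0ℤ * n
            identity = solve-∀

    ≡-mod-sym : ∀ {a b} → a ≡ b mod n → b ≡ a mod n
    ≡-mod-sym {b = b} (mod-by q refl) = mod-by (- q) (identity b q (+ n))
      where identity : ∀ b q n → b ≡ b + q * n + - q * n
            identity = solve-∀

    ≡-mod-trans : ∀ {a b c} → a ≡ b mod n → b ≡ c mod n → a ≡ c mod n
    ≡-mod-trans {c = c} (mod-by q refl) (mod-by r refl) = mod-by (r + q) (identity c r q (+ n))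
      where identity : ∀ c r q n → c + r * n + q * n ≡ c + (r + q) * n
            identity = solve-∀

    ≡-mod-isEquivalence : IsEquivalence (λ a b → a ≡ b mod n)
    ≡-mod-isEquivalence = record
      { refl = ≡⇒≡-mod refl ; sym = ≡-mod-sym ; trans = ≡-mod-trans }

    +-cong-mod : ∀ {a b c d} → a ≡ b mod n → c ≡ d mod n → a + c ≡ b + d mod n
    +-cong-mod {b = b} {d = d} (mod-by q refl) (mod-by r refl) =
      mod-by (q + r) (identity b d q r (+ n))
      where identity : ∀ b d q r n → b + q * n + (d + r * n) ≡ b + d + (q + r) * n
            identity = solve-∀

    neg-cong-mod : ∀ {a b} → a ≡ b mod n → - a ≡ - b mod n
    neg-cong-mod {b = b} (mod-by q refl) = mod-by (- q) (identity b q (+ n))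
      where identity : ∀ b q n → - (b + q * n) ≡ - b + - q * n
            identity = solve-∀

    *-congˡ-mod : ∀ c {a b} → a ≡ b mod n → c * a ≡ c * b mod n
    *-congˡ-mod c {b = b} (mod-by q refl) = mod-by (c * q) (identity b q c (+ n))
      where identity : ∀ b q c n → c * (b + q * n) ≡ c * b + c * q * n
            identity = solve-∀

    -‿cong-mod : ∀ {a b c d} → a ≡ b mod n → c ≡ d mod n → a - c ≡ b - d mod n
    -‿cong-mod p q = +-cong-mod p (neg-cong-mod q)

    +-congˡ-mod : ∀ a {b c} → b ≡ c mod n → a + b ≡ a + c mod n
    +-congˡ-mod a = +-cong-mod (≡⇒≡-mod {a = a} refl)

    -‿congˡ-mod : ∀ a {b c} → b ≡ c mod n → a - b ≡ a - c mod n
    -‿congˡ-mod a p = +-congˡ-mod a (neg-cong-mod p)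

    +-multiple-mod : ∀ a q → a + q * + n ≡ a mod n
    +-multiple-mod a q = mod-by q refl

  ≡-mod-setoid : ℕ → Setoid _ _
  ≡-mod-setoid n = record { isEquivalence = ≡-mod-isEquivalence {n} }

  module ≡-mod-Reasoning (n : ℕ) where
    open import Relation.Binary.Reasoning.Setoid (≡-mod-setoid n) public

  ≡-mod-weakenˡ : ∀ {m n a b} → a ≡ b mod (m ℕ.* n) → a ≡ b mod m
  ≡-mod-weakenˡ {m} {n} {b = b} (mod-by q refl) =
    mod-by (q * + n) (trans (cong (λ z → b + q * z) (ℤₚ.pos-* m n)) (identity b q (+ m) (+ n)))
    where identity : ∀ b q m n → b + q * (m * n) ≡ b + q * n * m
          identity = solve-∀

  ≡-mod-weakenʳ : ∀ {m n a b} → a ≡ b mod (m ℕ.* n) → a ≡ b mod n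
  ≡-mod-weakenʳ {m} {n} {b = b} (mod-by q eq) =
    ≡-mod-weakenˡ {n} {m} (mod-by q (trans eq (cong (λ z → b + q * + z) (ℕₚ.*-comm m n))))

  private
    pos-+-* : ∀ a b c → + (a ℕ.+ b ℕ.* c) ≡ + a + + b * + c
    pos-+-* a b c = trans (ℤₚ.pos-+ a (b ℕ.* c)) (cong (λ z → + a + z) (ℤₚ.pos-* b c))

  unit-mod : ∀ {m n} u k → u * + m ≡ 1ℤ + k * + n → ∀ a → u * (+ m * a) ≡ a mod n
  unit-mod {m} {n} u k um≡1+kn a = mod-by (k * a) (begin
    u * (+ m * a)       ≡⟨ assoc u (+ m) a ⟩
    u * + m * a         ≡⟨ cong (_* a) um≡1+kn ⟩
    (1ℤ + k * + n) * a  ≡⟨ expand k (+ n) a ⟩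
    a + k * a * + n     ∎)
    where
    open ≡-Reasoning
    assoc : ∀ u m a → u * (m * a) ≡ u * m * a
    assoc = solve-∀
    expand : ∀ k n a → (1ℤ + k * n) * a ≡ a + k * a * n
    expand = solve-∀

  inverse-mod : ∀ {m n} → Coprime m n → Σ ℤ λ u → ∀ a → u * (+ m * a) ≡ a mod n
  inverse-mod {m} {n} coprime with coprime-Bézout coprime
  ... | Bézout.+- x y eq = + x , unit-mod (+ x) (+ y) (begin
    + x * + m       ≡⟨ ℤₚ.pos-* x m ⟨
    + (x ℕ.* m)     ≡⟨ cong +_ eq ⟨
    + (1 ℕ.+ y ℕ.* n) ≡⟨ pos-+-* 1 y n ⟩
    1ℤ + + y * + n  ∎)
    where open ≡-Reasoning
  ... | Bézout.-+ x y eq = - + x , unit-mod (- + x) (- + y) (begin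
    - + x * + m              ≡⟨ ℤₚ.neg-distribˡ-* (+ x) (+ m) ⟨
    - (+ x * + m)            ≡⟨ cong -_ (ℤₚ.pos-* x m) ⟨
    - + (x ℕ.* m)            ≡⟨ shift (+ (x ℕ.* m)) ⟩
    1ℤ - (1ℤ + + (x ℕ.* m))  ≡⟨ cong (λ z → 1ℤ - z) (trans (sym (ℤₚ.pos-+ 1 (x ℕ.* m))) (cong +_ eq)) ⟩
    1ℤ - + (y ℕ.* n)         ≡⟨ cong (λ z → 1ℤ - z) (ℤₚ.pos-* y n) ⟩
    1ℤ - + y * + n           ≡⟨ regroup (+ y) (+ n) ⟩
    1ℤ + - + y * + n         ∎)
    where
    open ≡-Reasoning
    shift : ∀ a → - a ≡ 1ℤ - (1ℤ + a)
    shift = solve-∀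
    regroup : ∀ y n → 1ℤ - y * n ≡ 1ℤ + - y * n
    regroup = solve-∀

  *-cancelˡ-mod : ∀ {m n a b} → Coprime m n → + m * a ≡ + m * b mod n → a ≡ b mod n
  *-cancelˡ-mod {m} {n} {a} {b} coprime ma≡mb = begin
    a             ≈⟨ ≡-mod-sym (undo a) ⟩
    u * (+ m * a) ≈⟨ *-congˡ-mod u ma≡mb ⟩
    u * (+ m * b) ≈⟨ undo b ⟩
    b             ∎
    where
    open ≡-mod-Reasoning n
    u = proj₁ (inverse-mod coprime)
    undo = proj₂ (inverse-mod coprime)

  %-mod : ∀ k n .{{_ : NonZero n}} → + (k ℕ.% n) ≡ + k mod n
  %-mod k n = ≡-mod-sym (mod-by (+ (k ℕ./ n)) (begin
    + k                               ≡⟨ cong +_ (m≡m%n+[m/n]*n k n) ⟩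
    + (k ℕ.% n ℕ.+ k ℕ./ n ℕ.* n)     ≡⟨ pos-+-* (k ℕ.% n) (k ℕ./ n) n ⟩
    + (k ℕ.% n) + + (k ℕ./ n) * + n   ∎))
    where open ≡-Reasoning

  private
    no-positive-multiple : ∀ {n a b} k → a ℕ.< n → + a ≢ + b + +[1+ k ] * + n
    no-positive-multiple {n} {a} {b} k a<n eq = ℕₚ.<⇒≱ a<n (begin
      n                    ≤⟨ ℕₚ.m≤m+n n (k ℕ.* n) ⟩
      suc k ℕ.* n          ≤⟨ ℕₚ.m≤n+m (suc k ℕ.* n) b ⟩
      b ℕ.+ suc k ℕ.* n    ≡⟨ ℤₚ.+-injective (trans (pos-+-* b (suc k) n) (sym eq)) ⟩
      a                    ∎)
      where open ℕₚ.≤-Reasoning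

  ≡-mod⇒≡ : ∀ {n a b} → a ℕ.< n → b ℕ.< n → + a ≡ + b mod n → a ≡ b
  ≡-mod⇒≡ {n} {b = b} _ _ (mod-by (+ 0) eq) = ℤₚ.+-injective (trans eq (identity (+ b) (+ n)))
    where identity : ∀ b n → b + 0ℤ * n ≡ b
          identity = solve-∀
  ≡-mod⇒≡ a<n _ (mod-by +[1+ k ] eq) = ⊥-elim (no-positive-multiple k a<n eq)
  ≡-mod⇒≡ {n} {a} {b} _ b<n (mod-by q@(-[1+ k ]) eq) =
    ⊥-elim (no-positive-multiple k b<n (trans (identity (+ b) q (+ n)) (cong (_+ - q * + n) (sym eq))))
    where identity : ∀ b q n → b ≡ b + q * n + - q * n
          identity = solve-∀

  toℤ : ∀ {n} → Fin n → ℤ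
  toℤ x = + toℕ x

  toℤ-addₘ : ∀ {n} (x y : Fin n) → toℤ (x +ₘ y) ≡ toℤ x + toℤ y mod n
  toℤ-addₘ {suc m} x y = begin
    toℤ (x +ₘ y)                       ≡⟨ cong +_ (Finₚ.toℕ-fromℕ< (m%n<n (toℕ x ℕ.+ toℕ y) (suc m))) ⟩
    + ((toℕ x ℕ.+ toℕ y) ℕ.% suc m)    ≈⟨ %-mod (toℕ x ℕ.+ toℕ y) (suc m) ⟩
    + (toℕ x ℕ.+ toℕ y)                ≡⟨ ℤₚ.pos-+ (toℕ x) (toℕ y) ⟩
    toℤ x + toℤ y                      ∎
    where open ≡-mod-Reasoning (suc m)

  toℤ-negₘ : ∀ {n} (x : Fin n) → toℤ (-ₘ x) ≡ - toℤ x mod n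
  toℤ-negₘ {suc m} x = begin
    toℤ (-ₘ x)                    ≡⟨ cong +_ (Finₚ.toℕ-fromℕ< (m%n<n (suc m ℕ.∸ toℕ x) (suc m))) ⟩
    + ((suc m ℕ.∸ toℕ x) ℕ.% suc m) ≈⟨ %-mod (suc m ℕ.∸ toℕ x) (suc m) ⟩
    + (suc m ℕ.∸ toℕ x)           ≡⟨ ℤₚ.⊖-≥ (ℕₚ.<⇒≤ (Finₚ.toℕ<n x)) ⟨
    suc m ⊖ toℕ x                 ≡⟨ ℤₚ.m-n≡m⊖n (suc m) (toℕ x) ⟨
    + suc m - toℤ x               ≡⟨ regroup (+ suc m) (toℤ x) ⟩
    - toℤ x + 1ℤ * + suc m        ≈⟨ +-multiple-mod (- toℤ x) 1ℤ ⟩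
    - toℤ x                       ∎
    where
    open ≡-mod-Reasoning (suc m)
    regroup : ∀ n x → n - x ≡ - x + 1ℤ * n
    regroup = solve-∀

  toℤ-subₘ : ∀ {n} (x y : Fin n) → toℤ (x -ₘ y) ≡ toℤ x - toℤ y mod n
  toℤ-subₘ x y = ≡-mod-trans (toℤ-addₘ x (-ₘ y)) (+-congˡ-mod (toℤ x) (toℤ-negₘ y))

  toℤ-injective-mod : ∀ {n} {x y : Fin n} → toℤ x ≡ toℤ y mod n → x ≡ y
  toℤ-injective-mod {x = x} {y} eq = Finₚ.toℕ-injective (≡-mod⇒≡ (Finₚ.toℕ<n x) (Finₚ.toℕ<n y) eq)

  -ₘ-≡-from-mod : ∀ {n} {a b c d : Fin n} →
                  toℤ a - toℤ b ≡ toℤ c - toℤ d mod n → a -ₘ b ≡ c -ₘ d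
  -ₘ-≡-from-mod {n} {a} {b} {c} {d} eq = toℤ-injective-mod (begin
    toℤ (a -ₘ b)   ≈⟨ toℤ-subₘ a b ⟩
    toℤ a - toℤ b  ≈⟨ eq ⟩
    toℤ c - toℤ d  ≈⟨ toℤ-subₘ c d ⟨
    toℤ (c -ₘ d)   ∎)
    where open ≡-mod-Reasoning n

  -ₘ-cancelˡ : ∀ {n} (x : Fin n) {y z : Fin n} → x -ₘ y ≡ x -ₘ z → y ≡ z
  -ₘ-cancelˡ {n} x {y} {z} eq = toℤ-injective-mod (begin
    toℤ y                    ≡⟨ identity (toℤ x) (toℤ y) ⟩
    toℤ x - (toℤ x - toℤ y)  ≈⟨ -‿congˡ-mod (toℤ x) (toℤ-subₘ x y) ⟨
    toℤ x - toℤ (x -ₘ y)     ≡⟨ cong (λ w → toℤ x - toℤ w) eq ⟩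
    toℤ x - toℤ (x -ₘ z)     ≈⟨ -‿congˡ-mod (toℤ x) (toℤ-subₘ x z) ⟩
    toℤ x - (toℤ x - toℤ z)  ≡⟨ identity (toℤ x) (toℤ z) ⟨
    toℤ z                    ∎)
    where
    open ≡-mod-Reasoning n
    identity : ∀ a b → b ≡ a - (a - b)
    identity = solve-∀

open ModularArithmetic

private variable
  a r : Level
  A : Set a

Unique-++⁻ : ∀ (xs : List A) {ys} → Unique (xs ++ ys) → Unique xs × Unique ys × Disjoint xs ys
Unique-++⁻ []       u           = [] , u , λ ()
Unique-++⁻ (x ∷ xs) (x∉ ∷ u) with Unique-++⁻ xs u
... | uxs , uys , disjoint =
  (Allₚ.++⁻ˡ xs x∉ ∷ uxs) , uys , λ where
    (here refl , v∈ys) → All.lookup (Allₚ.++⁻ʳ xs x∉) v∈ys refl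
    (there v∈xs , v∈ys) → disjoint (v∈xs , v∈ys)

Unique-concat⁻ : ∀ (xss : List (List A)) → Unique (concat xss) → All Unique xss × AllPairs Disjoint xss
Unique-concat⁻ []         _ = [] , []
Unique-concat⁻ (xs ∷ xss) u with Unique-++⁻ xs u
... | uxs , urest , disjoint with Unique-concat⁻ xss urest
...   | uxss , pairwise =
  (uxs ∷ uxss) ,
  (All.tabulate (λ ys∈xss (v∈xs , v∈ys) → disjoint (v∈xs , ∈-concat⁺′ v∈ys ys∈xss)) ∷ pairwise)

module _ {R : Rel A r} where

  AllPairs-∈ : Symmetric R → ∀ {xs x y} → AllPairs R xs → x ∈ xs → y ∈ xs → x ≢ y → R x y
  AllPairs-∈ _   (_  ∷ _)   (here refl)  (here refl)  x≢y = contradiction refl x≢y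
  AllPairs-∈ _   (Rx ∷ _)   (here refl)  (there y∈)   _   = All.lookup Rx y∈
  AllPairs-∈ sym (Rx ∷ _)   (there x∈)   (here refl)  _   = sym (All.lookup Rx x∈)
  AllPairs-∈ sym (_  ∷ Rxs) (there x∈)   (there y∈)   x≢y = AllPairs-∈ sym Rxs x∈ y∈ x≢y

  Unique⇒AllPairs : ∀ {xs} → Unique xs → (∀ {x y} → x ∈ xs → y ∈ xs → x ≢ y → R x y) → AllPairs R xs
  Unique⇒AllPairs []          _  = []
  Unique⇒AllPairs (x∉ ∷ uxs) Rxy =
    All.tabulate (λ y∈ → Rxy (here refl) (there y∈) (All.lookup x∉ y∈)) ∷
    Unique⇒AllPairs uxs (λ x∈ y∈ → Rxy (there x∈) (there y∈))

Unique-tabulate⇒injective : ∀ {n} {f : Fin n → A} → Unique (tabulate f) → ∀ {i j} → f i ≡ f j → i ≡ j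
Unique-tabulate⇒injective         _         {zero}  {zero}  _  = refl
Unique-tabulate⇒injective         (f0∉ ∷ _) {zero}  {suc j} eq = contradiction eq (All.lookup f0∉ (∈-tabulate⁺ j))
Unique-tabulate⇒injective         (f0∉ ∷ _) {suc i} {zero}  eq = contradiction (sym eq) (All.lookup f0∉ (∈-tabulate⁺ i))
Unique-tabulate⇒injective {f = f} (_ ∷ u)   {suc i} {suc j} eq =
  cong suc (Unique-tabulate⇒injective {f = f ∘ suc} u eq)

tabulate-injective : ∀ {n} {f g : Fin n → A} → tabulate f ≡ tabulate g → ∀ i → f i ≡ g i
tabulate-injective eq zero    = Listₚ.∷-injectiveˡ eq
tabulate-injective eq (suc i) = tabulate-injective (Listₚ.∷-injectiveʳ eq) i

length-concatMap-const : ∀ {B : Set} (f : A → List B) {m} xs →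
                         All (λ x → length (f x) ≡ m) xs → length (concatMap f xs) ≡ length xs ℕ.* m
length-concatMap-const f []       []               = refl
length-concatMap-const f (x ∷ xs) (|fx|≡m ∷ |f|≡m) = begin
  length (f x ++ concatMap f xs)            ≡⟨ Listₚ.length-++ (f x) ⟩
  length (f x) ℕ.+ length (concatMap f xs)  ≡⟨ cong₂ ℕ._+_ |fx|≡m (length-concatMap-const f xs |f|≡m) ⟩
  _ ℕ.+ length xs ℕ.* _                     ∎
  where open ≡-Reasoning

module _ (_≟_ : DecidableEquality A) where

  open DecMembership _≟_ using (_∈?_)

  private
    others : A → List A → List A
    others x = filter (λ y → ¬? (x ≟ y))

  length-filter-≢ : ∀ {x xs} → Unique xs → x ∈ xs →
                    suc (length (filter (λ y → ¬? (x ≟ y)) xs)) ≡ length xs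
  length-filter-≢ {xs = y ∷ xs} (y∉ ∷ _) (here refl) =
    cong suc (cong length (trans (Listₚ.filter-reject (λ z → ¬? (y ≟ z)) (λ y≢y → y≢y refl))
                                 (Listₚ.filter-all _ y∉)))
  length-filter-≢ {x} {y ∷ xs} (y∉ ∷ u) (there x∈) =
    trans (cong (λ zs → suc (length zs)) (Listₚ.filter-accept (λ y → ¬? (x ≟ y)) x≢y))
          (cong suc (length-filter-≢ u x∈))
    where x≢y : x ≢ y
          x≢y refl = All.lookup y∉ x∈ refl

  Unique-⊆⇒length≤ : ∀ {xs ys : List A} → Unique xs → xs ⊆ ys → length xs ≤ length ys
  Unique-⊆⇒length≤ {[]}     _          _      = ℕ.z≤n
  Unique-⊆⇒length≤ {x ∷ xs} {ys} (x∉ ∷ u) x∷xs⊆ys = begin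
    suc (length xs)             ≤⟨ ℕ.s≤s (Unique-⊆⇒length≤ u xs⊆others) ⟩
    suc (length (others x ys))  ≤⟨ Listₚ.filter-notAll _ ys (Any.map (flip id) (x∷xs⊆ys (here refl))) ⟩
    length ys                   ∎
    where
    open ℕₚ.≤-Reasoning
    xs⊆others : xs ⊆ others x ys
    xs⊆others y∈ = ∈-filter⁺ _ (x∷xs⊆ys (there y∈)) (All.lookup x∉ y∈)

  private
    cover-too-short : ∀ {x xs ys} → Unique ys → ys ⊆ x ∷ xs → (x ∈ ys → x ∈ xs) →
                      length (x ∷ xs) ≤ length ys → ⊥
    cover-too-short {x} {xs} {ys} uys ys⊆ x∈xs-if |x∷xs|≤ =
      ℕₚ.<⇒≱ (ℕ.s≤s (Unique-⊆⇒length≤ uys ys⊆xs)) |x∷xs|≤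
      where ys⊆xs : ys ⊆ xs
            ys⊆xs y∈ with ys⊆ y∈
            ... | here refl  = x∈xs-if y∈
            ... | there y∈xs = y∈xs

  ⊇Unique⇒Unique : ∀ xs {ys : List A} → Unique ys → ys ⊆ xs → length xs ≤ length ys → Unique xs
  ⊇Unique⇒Unique []       _  _     _ = []
  ⊇Unique⇒Unique (x ∷ xs) {ys} uys ys⊆ |x∷xs|≤ with x ∈? xs | x ∈? ys
  ... | yes x∈xs | _       = ⊥-elim (cover-too-short uys ys⊆ (λ _ → x∈xs) |x∷xs|≤)
  ... | no _     | no x∉ys = ⊥-elim (cover-too-short uys ys⊆ (λ x∈ys → contradiction x∈ys x∉ys) |x∷xs|≤)
  ... | no x∉xs  | yes x∈ys =
    Allₚ.¬Any⇒All¬ xs x∉xs ∷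
    ⊇Unique⇒Unique xs (Uniqueₚ.filter⁺ _ uys) others⊆xs
      (ℕ.s≤s⁻¹ (ℕₚ.≤-trans |x∷xs|≤ (ℕₚ.≤-reflexive (sym (length-filter-≢ uys x∈ys)))))
    where
    others⊆xs : others x ys ⊆ xs
    others⊆xs y∈ with ∈-filter⁻ _ y∈
    ... | y∈ys , x≢y with ys⊆ y∈ys
    ...   | here refl  = contradiction refl x≢y
    ...   | there y∈xs = y∈xs

length-cartesianProduct : ∀ {B : Set} (xs : List A) (ys : List B) →
                          length (cartesianProduct xs ys) ≡ length xs ℕ.* length ys
length-cartesianProduct []       ys = refl
length-cartesianProduct (x ∷ xs) ys = begin
  length (map (x ,_) ys ++ cartesianProduct xs ys)
    ≡⟨ Listₚ.length-++ (map (x ,_) ys) ⟩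
  length (map (x ,_) ys) ℕ.+ length (cartesianProduct xs ys)
    ≡⟨ cong₂ ℕ._+_ (Listₚ.length-map (x ,_) ys) (length-cartesianProduct xs ys) ⟩
  length ys ℕ.+ length xs ℕ.* length ys
    ∎
  where open ≡-Reasoning

length-missing≤ : ∀ {n k d} (C : OOC n k) → n ≤ length (allDiffs (OOC.blocks C)) ℕ.+ d → length (missing C) ≤ d
length-missing≤ {n} {d = d} C n≤ = ℕₚ.+-cancelʳ-≤ (length L) (length M) d (begin
  length M ℕ.+ length L  ≡⟨ Listₚ.length-++ M ⟨
  length (M ++ L)        ≤⟨ Unique-⊆⇒length≤ _≟_ unique (λ {z} _ → ∈-allFin z) ⟩
  length (allFin n)      ≡⟨ Listₚ.length-tabulate id ⟩
  n                      ≤⟨ n≤ ⟩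
  length L ℕ.+ d         ≡⟨ ℕₚ.+-comm (length L) d ⟩
  d ℕ.+ length L         ∎)
  where
  open ℕₚ.≤-Reasoning
  open DecMembership (_≟_ {n}) using (_∈?_)
  L = allDiffs (OOC.blocks C)
  M = missing C
  unique : Unique (M ++ L)
  unique = Uniqueₚ.++⁺ (Uniqueₚ.filter⁺ _ (Uniqueₚ.allFin⁺ n)) (OOC.noRepeat C)
                       (λ (z∈M , z∈L) → proj₂ (∈-filter⁻ (λ z → ¬? (z ∈? L)) {xs = allFin n} z∈M) z∈L)

module Configurations {n k : ℕ} {T : Set} (point : T → Fin k → Fin n) where

  block : T → List (Fin n)
  block t = tabulate (point t)

  Δ : T → Fin k → Fin k → Fin n
  Δ t i j = point t i -ₘ point t j

  DifferencesInjectiveOn : List T → Set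
  DifferencesInjectiveOn J = ∀ {t t' i j i' j'} → t ∈ J → t' ∈ J → i ≢ j → i' ≢ j' →
                             Δ t i j ≡ Δ t' i' j' → (t , i , j) ≡ (t' , i' , j')

  private
    differencesFrom : List (Fin n) → Fin n → List (Fin n)
    differencesFrom B x = map (λ y → x -ₘ y) (filter (λ y → ¬? (x ≟ y)) B)

  ∈-differencesFrom⁻ : ∀ {t i w} → w ∈ differencesFrom (block t) (point t i) →
                       ∃ λ j → i ≢ j × w ≡ Δ t i j
  ∈-differencesFrom⁻ {t} {i} w∈ with ∈-map⁻ (λ y → point t i -ₘ y) w∈
  ... | y , y∈ , refl with ∈-filter⁻ (λ y → ¬? (point t i ≟ y)) y∈
  ...   | y∈B , x≢y with ∈-tabulate⁻ {f = point t} y∈B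
  ...     | j , refl = j , (λ { refl → x≢y refl }) , refl

  ∈-diffs-block⁻ : ∀ {t w} → w ∈ diffs (block t) → ∃₂ λ i j → i ≢ j × w ≡ Δ t i j
  ∈-diffs-block⁻ {t} w∈ with ∈-concat⁻′ (map (differencesFrom (block t)) (block t)) w∈
  ... | ws , w∈ws , ws∈ with ∈-map⁻ (differencesFrom (block t)) ws∈
  ...   | x , x∈B , refl with ∈-tabulate⁻ {f = point t} x∈B
  ...     | i , refl = i , ∈-differencesFrom⁻ w∈ws

  module _ {J : List T} (injective : DifferencesInjectiveOn J) where

    point-injective : ∀ {t i j} → t ∈ J → point t i ≡ point t j → i ≡ j
    point-injective {t} {i} {j} t∈ eq with Fin._≟_ i j
    ... | yes i≡j = i≡j
    ... | no i≢j = cong (λ (_ , i , _) → i) (injective t∈ t∈ i≢j (i≢j ∘ sym) Δij≡Δji)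
      where
      Δij≡Δji : Δ t i j ≡ Δ t j i
      Δij≡Δji = trans (cong (_-ₘ point t j) eq) (cong (λ z → point t j -ₘ z) (sym eq))

    block-Unique : ∀ {t} → t ∈ J → Unique (block t)
    block-Unique t∈ = Uniqueₚ.tabulate⁺ (point-injective t∈)

    diffs-block-Unique : ∀ {t} → t ∈ J → Unique (diffs (block t))
    diffs-block-Unique {t} t∈ = Uniqueₚ.concat⁺
      (Allₚ.map⁺ (All.tabulate λ {x} _ →
        Uniqueₚ.map⁺ (-ₘ-cancelˡ x) (Uniqueₚ.filter⁺ _ (block-Unique t∈))))
      (AllPairsₚ.map⁺ (AllPairsₚ.tabulate⁺ disjoint))
      where
      disjoint : ∀ {i i'} → i ≢ i' → Disjoint (differencesFrom (block t) (point t i))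
                                               (differencesFrom (block t) (point t i'))
      disjoint i≢i' (w∈ , w∈') with ∈-differencesFrom⁻ w∈ | ∈-differencesFrom⁻ w∈'
      ... | j , i≢j , refl | j' , i'≢j' , eq =
        i≢i' (cong (λ (_ , i , _) → i) (injective t∈ t∈ i≢j i'≢j' eq))

    length-diffs-block : ∀ {t} → t ∈ J → length (diffs (block t)) ≡ k ℕ.* (k ℕ.∸ 1)
    length-diffs-block {t} t∈ = begin
      length (diffs (block t))        ≡⟨ length-concatMap-const (differencesFrom (block t)) (block t)
                                           (All.tabulate (λ x∈ → length-differencesFrom x∈)) ⟩
      length (block t) ℕ.* (k ℕ.∸ 1)      ≡⟨ cong (ℕ._* (k ℕ.∸ 1)) (Listₚ.length-tabulate (point t)) ⟩
      k ℕ.* (k ℕ.∸ 1)                     ∎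
      where
      open ≡-Reasoning
      length-differencesFrom : ∀ {x} → x ∈ block t → length (differencesFrom (block t) x) ≡ k ℕ.∸ 1
      length-differencesFrom {x} x∈ = begin
        length (differencesFrom (block t) x)          ≡⟨ Listₚ.length-map _ (filter _ (block t)) ⟩
        length (filter (λ y → ¬? (x ≟ y)) (block t))  ≡⟨ cong (ℕ._∸ 1) (length-filter-≢ _≟_ (block-Unique t∈) x∈) ⟩
        length (block t) ℕ.∸ 1                        ≡⟨ cong (ℕ._∸ 1) (Listₚ.length-tabulate (point t)) ⟩
        k ℕ.∸ 1                                       ∎

    configurations⇒OOC : Unique J → {i₀ i₁ : Fin k} → i₀ ≢ i₁ →
      Σ (OOC n k) λ C → length (allDiffs (OOC.blocks C)) ≡ length J ℕ.* (k ℕ.* (k ℕ.∸ 1))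
    configurations⇒OOC uniqueJ {i₀} {i₁} i₀≢i₁ = record
      { blocks   = map block J
      ; distinct = AllPairsₚ.map⁺ (Unique⇒AllPairs uniqueJ blocks-distinct)
      ; ksubsets = ksubsets
      ; noRepeat = Uniqueₚ.concat⁺
          (Allₚ.map⁺ (Allₚ.map⁺ (All.tabulate diffs-block-Unique)))
          (AllPairsₚ.map⁺ (AllPairsₚ.map⁺ (Unique⇒AllPairs uniqueJ diffs-disjoint)))
      } , (begin
      length (allDiffs (map block J))
        ≡⟨ length-concatMap-const diffs (map block J) (Allₚ.map⁺ (All.tabulate length-diffs-block)) ⟩
      length (map block J) ℕ.* (k ℕ.* (k ℕ.∸ 1))
        ≡⟨ cong (ℕ._* (k ℕ.* (k ℕ.∸ 1))) (Listₚ.length-map block J) ⟩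
      length J ℕ.* (k ℕ.* (k ℕ.∸ 1))
        ∎)
      where
      open ≡-Reasoning
      diffs-disjoint : ∀ {t t'} → t ∈ J → t' ∈ J → t ≢ t' → Disjoint (diffs (block t)) (diffs (block t'))
      diffs-disjoint t∈ t'∈ t≢t' (w∈ , w∈') with ∈-diffs-block⁻ w∈ | ∈-diffs-block⁻ w∈'
      ... | i , j , i≢j , refl | i' , j' , i'≢j' , eq = t≢t' (cong proj₁ (injective t∈ t'∈ i≢j i'≢j' eq))
      blocks-distinct : ∀ {t t'} → t ∈ J → t' ∈ J → t ≢ t' → block t ≢ block t'
      blocks-distinct t∈ t'∈ t≢t' eq = t≢t' (cong proj₁ (injective t∈ t'∈ i₀≢i₁ i₀≢i₁
        (cong₂ _-ₘ_ (tabulate-injective eq i₀) (tabulate-injective eq i₁))))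
      ksubsets : ∀ B → B ∈ map block J → IsKSubset k B
      ksubsets B B∈ with ∈-map⁻ block B∈
      ... | t , t∈ , refl = block-Unique t∈ , Listₚ.length-tabulate (point t)

module ChineseRemainder (m n : ℕ) .{{_ : NonZero m}} .{{_ : NonZero n}} (coprime : Coprime m n) where

  open import Data.Integer using (_+_; _*_; _-_)

  private instance
    mn≢0 : NonZero (m ℕ.* n)
    mn≢0 = ℕₚ.m*n≢0 m n

  crt : Fin m → Fin n → Fin (m ℕ.* n)
  crt a s = fromℕ< (m%n<n (n ℕ.* toℕ a ℕ.+ m ℕ.* toℕ s) (m ℕ.* n))

  toℤ-crt : ∀ a s → toℤ (crt a s) ≡ + n * toℤ a + + m * toℤ s mod (m ℕ.* n)
  toℤ-crt a s = begin
    toℤ (crt a s)                                    ≡⟨ cong +_ (Finₚ.toℕ-fromℕ< _) ⟩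
    + ((n ℕ.* toℕ a ℕ.+ m ℕ.* toℕ s) ℕ.% (m ℕ.* n))  ≈⟨ %-mod _ (m ℕ.* n) ⟩
    + (n ℕ.* toℕ a ℕ.+ m ℕ.* toℕ s)                  ≡⟨ ℤₚ.pos-+ (n ℕ.* toℕ a) _ ⟩
    + (n ℕ.* toℕ a) + + (m ℕ.* toℕ s)                ≡⟨ cong₂ _+_ (ℤₚ.pos-* n (toℕ a)) (ℤₚ.pos-* m (toℕ s)) ⟩
    + n * toℤ a + + m * toℤ s                        ∎
    where open ≡-mod-Reasoning (m ℕ.* n)

  private
    toℤ-crt-difference : ∀ a s a' s' →
      toℤ (crt a s -ₘ crt a' s') ≡ (+ n * toℤ a + + m * toℤ s) - (+ n * toℤ a' + + m * toℤ s') mod (m ℕ.* n)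
    toℤ-crt-difference a s a' s' =
      ≡-mod-trans (toℤ-subₘ (crt a s) (crt a' s')) (-‿cong-mod (toℤ-crt a s) (toℤ-crt a' s'))

    crt-difference-mod-m : ∀ a s a' s' → toℤ (crt a s -ₘ crt a' s') ≡ + n * (toℤ a - toℤ a') mod m
    crt-difference-mod-m a s a' s' = begin
      toℤ (crt a s -ₘ crt a' s')
        ≈⟨ ≡-mod-weakenˡ {m} {n} (toℤ-crt-difference a s a' s') ⟩
      (+ n * toℤ a + + m * toℤ s) - (+ n * toℤ a' + + m * toℤ s')
        ≡⟨ regroup (+ n) (+ m) (toℤ a) (toℤ s) (toℤ a') (toℤ s') ⟩
      + n * (toℤ a - toℤ a') + (toℤ s - toℤ s') * + m
        ≈⟨ +-multiple-mod (+ n * (toℤ a - toℤ a')) (toℤ s - toℤ s') ⟩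
      + n * (toℤ a - toℤ a')
        ∎
      where
      open ≡-mod-Reasoning m
      regroup : ∀ n m a s a' s' → (n * a + m * s) - (n * a' + m * s') ≡ n * (a - a') + (s - s') * m
      regroup = solve-∀

    crt-difference-mod-n : ∀ a s a' s' → toℤ (crt a s -ₘ crt a' s') ≡ + m * (toℤ s - toℤ s') mod n
    crt-difference-mod-n a s a' s' = begin
      toℤ (crt a s -ₘ crt a' s')
        ≈⟨ ≡-mod-weakenʳ {m} {n} (toℤ-crt-difference a s a' s') ⟩
      (+ n * toℤ a + + m * toℤ s) - (+ n * toℤ a' + + m * toℤ s')
        ≡⟨ regroup (+ n) (+ m) (toℤ a) (toℤ s) (toℤ a') (toℤ s') ⟩
      + m * (toℤ s - toℤ s') + (toℤ a - toℤ a') * + n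
        ≈⟨ +-multiple-mod (+ m * (toℤ s - toℤ s')) (toℤ a - toℤ a') ⟩
      + m * (toℤ s - toℤ s')
        ∎
      where
      open ≡-mod-Reasoning n
      regroup : ∀ n m a s a' s' → (n * a + m * s) - (n * a' + m * s') ≡ m * (s - s') + (a - a') * n
      regroup = solve-∀

  crt-difference : ∀ {a s a' s' b t b' t'} → crt a s -ₘ crt a' s' ≡ crt b t -ₘ crt b' t' →
                   (a -ₘ a' ≡ b -ₘ b') × (toℤ s - toℤ s' ≡ toℤ t - toℤ t' mod n)
  crt-difference {a} {s} {a'} {s'} {b} {t} {b'} {t'} eq =
    -ₘ-≡-from-mod (*-cancelˡ-mod (Coprimality.sym coprime) (let open ≡-mod-Reasoning m in begin
      + n * (toℤ a - toℤ a')        ≈⟨ crt-difference-mod-m a s a' s' ⟨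
      toℤ (crt a s -ₘ crt a' s')    ≡⟨ cong toℤ eq ⟩
      toℤ (crt b t -ₘ crt b' t')    ≈⟨ crt-difference-mod-m b t b' t' ⟩
      + n * (toℤ b - toℤ b')        ∎)) ,
    *-cancelˡ-mod coprime (let open ≡-mod-Reasoning n in begin
      + m * (toℤ s - toℤ s')        ≈⟨ crt-difference-mod-n a s a' s' ⟨
      toℤ (crt a s -ₘ crt a' s')    ≡⟨ cong toℤ eq ⟩
      toℤ (crt b t -ₘ crt b' t')    ≈⟨ crt-difference-mod-n b t b' t' ⟩
      + m * (toℤ t - toℤ t')        ∎)

data Kind : Set where
  plain diffsum : Kind

orbit : ∀ {v} → Kind → Fin v × Fin v → List (Fin v)
orbit plain   = ±pair
orbit diffsum = ±diffsum

module _ {w : ℕ} (ps : PS (suc w)) where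

  open PS ps using (pairs; cover₁; cover₂)

  orbits-cover : ∀ κ z → z ∈ concatMap (orbit κ) pairs → toℕ z ≢ 0
  orbits-cover plain   z = Equivalence.to (cover₁ z)
  orbits-cover diffsum z = Equivalence.to (cover₂ z)

  orbits-Unique : length pairs ℕ.* 4 ≡ w → ∀ κ → Unique (concatMap (orbit κ) pairs)
  orbits-Unique |pairs|*4≡w κ =
    ⊇Unique⇒Unique _≟_ (concatMap (orbit κ) pairs) (Uniqueₚ.map⁺ Finₚ.suc-injective (Uniqueₚ.allFin⁺ w))
      nonzero⊆orbits (ℕₚ.≤-reflexive (begin
        length (concatMap (orbit κ) pairs)  ≡⟨ length-concatMap-const (orbit κ) pairs
                                                 (All.universal (length-orbit κ) pairs) ⟩
        length pairs ℕ.* 4                  ≡⟨ |pairs|*4≡w ⟩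
        w                                   ≡⟨ Listₚ.length-tabulate {n = w} id ⟨
        length (allFin w)                   ≡⟨ Listₚ.length-map suc (allFin w) ⟨
        length (map suc (allFin w))         ∎))
    where
    open ≡-Reasoning
    length-orbit : ∀ κ (p : Fin (suc w) × Fin (suc w)) → length (orbit κ p) ≡ 4
    length-orbit plain   _ = refl
    length-orbit diffsum _ = refl
    cover : ∀ κ z → toℕ z ≢ 0 → z ∈ concatMap (orbit κ) pairs
    cover plain   z = Equivalence.from (cover₁ z)
    cover diffsum z = Equivalence.from (cover₂ z)
    nonzero⊆orbits : ∀ {z} → z ∈ map suc (allFin w) → z ∈ concatMap (orbit κ) pairs
    nonzero⊆orbits z∈ with ∈-map⁻ suc z∈
    ... | i , _ , refl = cover κ (suc i) (λ ())

module LinearForms where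

  open import Data.Integer using (_+_; _*_; -_; _-_)

  Form : Set
  Form = ℤ × ℤ

  eval : Form → ℤ × ℤ → ℤ
  eval (α , β) (x , y) = α * x + β * y

  _-ᶠ_ : Form → Form → Form
  (α , β) -ᶠ (α′ , β′) = (α - α′ , β - β′)

  _·ᶠ_ : ℕ → Form → Form
  m ·ᶠ (α , β) = (+ m * α , + m * β)

  eval-subᶠ : ∀ f g X → eval (f -ᶠ g) X ≡ eval f X - eval g X
  eval-subᶠ (α , β) (α′ , β′) (x , y) = identity α β α′ β′ x y
    where identity : ∀ α β α′ β′ x y →
                     (α - α′) * x + (β - β′) * y ≡ (α * x + β * y) - (α′ * x + β′ * y)
          identity = solve-∀

  eval-scaleᶠ : ∀ m f X → eval (m ·ᶠ f) X ≡ + m * eval f X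
  eval-scaleᶠ m (α , β) (x , y) = identity (+ m) α β x y
    where identity : ∀ m α β x y → m * α * x + m * β * y ≡ m * (α * x + β * y)
          identity = solve-∀

  toℤ² : ∀ {v} → Fin v × Fin v → ℤ × ℤ
  toℤ² (x , y) = toℤ x , toℤ y

  data Coordinate : Set where
    o +x -x +y -y : Coordinate

  coordinateForm : Coordinate → Form
  coordinateForm o  = 0ℤ , 0ℤ
  coordinateForm +x = 1ℤ , 0ℤ
  coordinateForm -x = - 1ℤ , 0ℤ
  coordinateForm +y = 0ℤ , 1ℤ
  coordinateForm -y = 0ℤ , - 1ℤ

  elementForm : Kind → Fin 4 → Form
  elementForm plain   k = coordinateForm (lookup (+x ∷ -x ∷ +y ∷ -y ∷ []) k)
  elementForm diffsum zero                   = 1ℤ , - 1ℤ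
  elementForm diffsum (suc zero)             = - 1ℤ , 1ℤ
  elementForm diffsum (suc (suc zero))       = 1ℤ , 1ℤ
  elementForm diffsum (suc (suc (suc zero))) = - 1ℤ , - 1ℤ

  module _ {w : ℕ} where

    private
      v = suc w
      P = Fin v × Fin v

    coordinate : Coordinate → P → Fin v
    coordinate o  _       = zero
    coordinate +x (x , _) = x
    coordinate -x (x , _) = -ₘ x
    coordinate +y (_ , y) = y
    coordinate -y (_ , y) = -ₘ y

    coordinate-form : ∀ c p → toℤ (coordinate c p) ≡ eval (coordinateForm c) (toℤ² p) mod v
    coordinate-form o  (x , y) = ≡⇒≡-mod (identity (toℤ x) (toℤ y))
      where identity : ∀ x y → 0ℤ ≡ 0ℤ * x + 0ℤ * y
            identity = solve-∀
    coordinate-form +x (x , y) = ≡⇒≡-mod (identity (toℤ x) (toℤ y))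
      where identity : ∀ x y → x ≡ 1ℤ * x + 0ℤ * y
            identity = solve-∀
    coordinate-form -x (x , y) = ≡-mod-trans (toℤ-negₘ x) (≡⇒≡-mod (identity (toℤ x) (toℤ y)))
      where identity : ∀ x y → - x ≡ - 1ℤ * x + 0ℤ * y
            identity = solve-∀
    coordinate-form +y (x , y) = ≡⇒≡-mod (identity (toℤ x) (toℤ y))
      where identity : ∀ x y → y ≡ 0ℤ * x + 1ℤ * y
            identity = solve-∀
    coordinate-form -y (x , y) = ≡-mod-trans (toℤ-negₘ y) (≡⇒≡-mod (identity (toℤ x) (toℤ y)))
      where identity : ∀ x y → - y ≡ 0ℤ * x + - 1ℤ * y
            identity = solve-∀

    element : Kind → P → Fin 4 → Fin v
    element plain   p = List.lookup (±pair p)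
    element diffsum p = List.lookup (±diffsum p)

    orbit-tabulate : ∀ κ p → tabulate (element κ p) ≡ orbit κ p
    orbit-tabulate plain   p = refl
    orbit-tabulate diffsum p = refl

    element-form : ∀ κ p k → toℤ (element κ p k) ≡ eval (elementForm κ k) (toℤ² p) mod v
    element-form plain p zero                   = coordinate-form +x p
    element-form plain p (suc zero)             = coordinate-form -x p
    element-form plain p (suc (suc zero))       = coordinate-form +y p
    element-form plain p (suc (suc (suc zero))) = coordinate-form -y p
    element-form diffsum (x , y) zero =
      ≡-mod-trans (toℤ-subₘ x y) (≡⇒≡-mod (identity (toℤ x) (toℤ y)))
      where identity : ∀ x y → x - y ≡ 1ℤ * x + - 1ℤ * y
            identity = solve-∀
    element-form diffsum (x , y) (suc zero) =
      ≡-mod-trans (toℤ-negₘ (x -ₘ y))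
        (≡-mod-trans (neg-cong-mod (toℤ-subₘ x y)) (≡⇒≡-mod (identity (toℤ x) (toℤ y))))
      where identity : ∀ x y → - (x - y) ≡ - 1ℤ * x + 1ℤ * y
            identity = solve-∀
    element-form diffsum (x , y) (suc (suc zero)) =
      ≡-mod-trans (toℤ-addₘ x y) (≡⇒≡-mod (identity (toℤ x) (toℤ y)))
      where identity : ∀ x y → x + y ≡ 1ℤ * x + 1ℤ * y
            identity = solve-∀
    element-form diffsum (x , y) (suc (suc (suc zero))) =
      ≡-mod-trans (toℤ-negₘ (x +ₘ y))
        (≡-mod-trans (neg-cong-mod (toℤ-addₘ x y)) (≡⇒≡-mod (identity (toℤ x) (toℤ y))))
      where identity : ∀ x y → - (x + y) ≡ - 1ℤ * x + - 1ℤ * y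
            identity = solve-∀

open LinearForms

-- Over each pair (x , y) lie nine blocks whose points (a , c) ∈ ℤ₄₅ × ℤ_v are listed in pairBlocks; the two
-- baseBlocks have ℤ_v-coordinate 0 throughout. pairPreimage and basePreimage invert the difference map
-- (see PairCertificate); basePreimage is arbitrary at the five classes that the base blocks miss.

data Multiplier : Set where
  once twice : Multiplier

factor : Multiplier → ℕ
factor once  = 1
factor twice = 2

pairBlocks : Vec (Vec (ℕ × Coordinate) 5) 9
pairBlocks =
    (( 0 , o ) ∷ ( 1 , +x) ∷ (44 , +y) ∷ ( 1 , -x) ∷ (44 , -y) ∷ [])
  ∷ (( 0 , o ) ∷ ( 5 , +x) ∷ (24 , -x) ∷ (16 , +y) ∷ (36 , -y) ∷ [])
  ∷ (( 0 , o ) ∷ ( 9 , +x) ∷ (29 , -x) ∷ (40 , +y) ∷ (21 , -y) ∷ [])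
  ∷ (( 0 , o ) ∷ (15 , +x) ∷ (18 , -x) ∷ (22 , +y) ∷ (28 , -y) ∷ [])
  ∷ (( 0 , o ) ∷ (17 , +x) ∷ (23 , -x) ∷ (30 , +y) ∷ (27 , -y) ∷ [])
  ∷ (( 0 , o ) ∷ (18 , +x) ∷ (15 , -x) ∷ (28 , +y) ∷ (22 , -y) ∷ [])
  ∷ (( 0 , o ) ∷ (23 , +x) ∷ (17 , -x) ∷ (27 , +y) ∷ (30 , -y) ∷ [])
  ∷ (( 0 , o ) ∷ (24 , +x) ∷ ( 5 , -x) ∷ (36 , +y) ∷ (16 , -y) ∷ [])
  ∷ (( 0 , o ) ∷ (29 , +x) ∷ ( 9 , -x) ∷ (21 , +y) ∷ (40 , -y) ∷ [])
  ∷ []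

baseBlocks : Vec (Vec ℕ 5) 2
baseBlocks = (0 ∷ 32 ∷ 21 ∷ 23 ∷ 37 ∷ []) ∷ (0 ∷ 20 ∷ 38 ∷ 39 ∷ 35 ∷ []) ∷ []

classKind : Vec Kind 45
classKind =
    plain ∷ plain ∷ diffsum ∷ plain ∷ diffsum ∷ plain ∷ plain ∷ diffsum ∷ diffsum
  ∷ plain ∷ diffsum ∷ diffsum ∷ diffsum ∷ diffsum ∷ diffsum ∷ plain ∷ plain ∷ plain
  ∷ plain ∷ plain ∷ plain ∷ plain ∷ plain ∷ plain ∷ plain ∷ plain ∷ plain
  ∷ plain ∷ plain ∷ plain ∷ plain ∷ diffsum ∷ diffsum ∷ diffsum ∷ diffsum ∷ diffsum
  ∷ plain ∷ diffsum ∷ diffsum ∷ plain ∷ plain ∷ diffsum ∷ plain ∷ diffsum ∷ plain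
  ∷ []

classMultiplier : Vec Multiplier 45
classMultiplier =
    twice ∷ once ∷ once ∷ twice ∷ once ∷ once ∷ twice ∷ once ∷ once
  ∷ once ∷ once ∷ once ∷ once ∷ once ∷ once ∷ once ∷ once ∷ once
  ∷ once ∷ twice ∷ twice ∷ once ∷ once ∷ once ∷ once ∷ twice ∷ twice
  ∷ once ∷ once ∷ once ∷ once ∷ once ∷ once ∷ once ∷ once ∷ once
  ∷ once ∷ once ∷ once ∷ twice ∷ once ∷ once ∷ twice ∷ once ∷ once
  ∷ []

pairPreimage : Vec (Vec (Fin 9 × Fin 5 × Fin 5) 4) 45
pairPreimage =
    ((# 0 , # 1 , # 3) ∷ (# 0 , # 3 , # 1) ∷ (# 0 , # 2 , # 4) ∷ (# 0 , # 4 , # 2) ∷ [])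
  ∷ ((# 0 , # 1 , # 0) ∷ (# 0 , # 3 , # 0) ∷ (# 0 , # 0 , # 4) ∷ (# 0 , # 0 , # 2) ∷ [])
  ∷ ((# 0 , # 1 , # 2) ∷ (# 0 , # 3 , # 4) ∷ (# 0 , # 1 , # 4) ∷ (# 0 , # 3 , # 2) ∷ [])
  ∷ ((# 5 , # 1 , # 2) ∷ (# 3 , # 2 , # 1) ∷ (# 4 , # 3 , # 4) ∷ (# 6 , # 4 , # 3) ∷ [])
  ∷ ((# 4 , # 4 , # 2) ∷ (# 6 , # 3 , # 1) ∷ (# 3 , # 3 , # 2) ∷ (# 5 , # 4 , # 1) ∷ [])
  ∷ ((# 1 , # 1 , # 0) ∷ (# 7 , # 2 , # 0) ∷ (# 8 , # 0 , # 4) ∷ (# 2 , # 0 , # 3) ∷ [])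
  ∷ ((# 6 , # 1 , # 2) ∷ (# 4 , # 2 , # 1) ∷ (# 5 , # 3 , # 4) ∷ (# 3 , # 4 , # 3) ∷ [])
  ∷ ((# 5 , # 4 , # 2) ∷ (# 3 , # 3 , # 1) ∷ (# 4 , # 3 , # 2) ∷ (# 6 , # 4 , # 1) ∷ [])
  ∷ ((# 8 , # 1 , # 3) ∷ (# 2 , # 2 , # 4) ∷ (# 7 , # 1 , # 4) ∷ (# 1 , # 2 , # 3) ∷ [])
  ∷ ((# 2 , # 1 , # 0) ∷ (# 8 , # 2 , # 0) ∷ (# 1 , # 0 , # 4) ∷ (# 7 , # 0 , # 3) ∷ [])
  ∷ ((# 3 , # 4 , # 2) ∷ (# 5 , # 3 , # 1) ∷ (# 6 , # 3 , # 2) ∷ (# 4 , # 4 , # 1) ∷ [])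
  ∷ ((# 7 , # 4 , # 2) ∷ (# 1 , # 3 , # 1) ∷ (# 2 , # 3 , # 2) ∷ (# 8 , # 4 , # 1) ∷ [])
  ∷ ((# 1 , # 4 , # 2) ∷ (# 7 , # 3 , # 1) ∷ (# 8 , # 3 , # 2) ∷ (# 2 , # 4 , # 1) ∷ [])
  ∷ ((# 6 , # 4 , # 2) ∷ (# 4 , # 3 , # 1) ∷ (# 5 , # 3 , # 2) ∷ (# 3 , # 4 , # 1) ∷ [])
  ∷ ((# 2 , # 1 , # 3) ∷ (# 8 , # 2 , # 4) ∷ (# 1 , # 1 , # 4) ∷ (# 7 , # 2 , # 3) ∷ [])
  ∷ ((# 3 , # 1 , # 0) ∷ (# 5 , # 2 , # 0) ∷ (# 6 , # 0 , # 4) ∷ (# 4 , # 0 , # 3) ∷ [])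
  ∷ ((# 2 , # 0 , # 2) ∷ (# 8 , # 0 , # 1) ∷ (# 1 , # 3 , # 0) ∷ (# 7 , # 4 , # 0) ∷ [])
  ∷ ((# 4 , # 1 , # 0) ∷ (# 6 , # 2 , # 0) ∷ (# 3 , # 0 , # 4) ∷ (# 5 , # 0 , # 3) ∷ [])
  ∷ ((# 5 , # 1 , # 0) ∷ (# 3 , # 2 , # 0) ∷ (# 4 , # 0 , # 4) ∷ (# 6 , # 0 , # 3) ∷ [])
  ∷ ((# 7 , # 1 , # 2) ∷ (# 1 , # 2 , # 1) ∷ (# 2 , # 3 , # 4) ∷ (# 8 , # 4 , # 3) ∷ [])
  ∷ ((# 8 , # 1 , # 2) ∷ (# 2 , # 2 , # 1) ∷ (# 7 , # 3 , # 4) ∷ (# 1 , # 4 , # 3) ∷ [])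
  ∷ ((# 1 , # 0 , # 2) ∷ (# 7 , # 0 , # 1) ∷ (# 8 , # 3 , # 0) ∷ (# 2 , # 4 , # 0) ∷ [])
  ∷ ((# 4 , # 0 , # 2) ∷ (# 6 , # 0 , # 1) ∷ (# 3 , # 3 , # 0) ∷ (# 5 , # 4 , # 0) ∷ [])
  ∷ ((# 6 , # 1 , # 0) ∷ (# 4 , # 2 , # 0) ∷ (# 5 , # 0 , # 4) ∷ (# 3 , # 0 , # 3) ∷ [])
  ∷ ((# 7 , # 1 , # 0) ∷ (# 1 , # 2 , # 0) ∷ (# 2 , # 0 , # 4) ∷ (# 8 , # 0 , # 3) ∷ [])
  ∷ ((# 2 , # 1 , # 2) ∷ (# 8 , # 2 , # 1) ∷ (# 1 , # 3 , # 4) ∷ (# 7 , # 4 , # 3) ∷ [])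
  ∷ ((# 1 , # 1 , # 2) ∷ (# 7 , # 2 , # 1) ∷ (# 8 , # 3 , # 4) ∷ (# 2 , # 4 , # 3) ∷ [])
  ∷ ((# 3 , # 0 , # 2) ∷ (# 5 , # 0 , # 1) ∷ (# 6 , # 3 , # 0) ∷ (# 4 , # 4 , # 0) ∷ [])
  ∷ ((# 6 , # 0 , # 2) ∷ (# 4 , # 0 , # 1) ∷ (# 5 , # 3 , # 0) ∷ (# 3 , # 4 , # 0) ∷ [])
  ∷ ((# 8 , # 1 , # 0) ∷ (# 2 , # 2 , # 0) ∷ (# 7 , # 0 , # 4) ∷ (# 1 , # 0 , # 3) ∷ [])
  ∷ ((# 5 , # 0 , # 2) ∷ (# 3 , # 0 , # 1) ∷ (# 4 , # 3 , # 0) ∷ (# 6 , # 4 , # 0) ∷ [])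
  ∷ ((# 8 , # 4 , # 2) ∷ (# 2 , # 3 , # 1) ∷ (# 7 , # 3 , # 2) ∷ (# 1 , # 4 , # 1) ∷ [])
  ∷ ((# 4 , # 1 , # 3) ∷ (# 6 , # 2 , # 4) ∷ (# 3 , # 1 , # 4) ∷ (# 5 , # 2 , # 3) ∷ [])
  ∷ ((# 7 , # 1 , # 3) ∷ (# 1 , # 2 , # 4) ∷ (# 2 , # 1 , # 4) ∷ (# 8 , # 2 , # 3) ∷ [])
  ∷ ((# 1 , # 1 , # 3) ∷ (# 7 , # 2 , # 4) ∷ (# 8 , # 1 , # 4) ∷ (# 2 , # 2 , # 3) ∷ [])
  ∷ ((# 5 , # 1 , # 3) ∷ (# 3 , # 2 , # 4) ∷ (# 4 , # 1 , # 4) ∷ (# 6 , # 2 , # 3) ∷ [])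
  ∷ ((# 8 , # 0 , # 2) ∷ (# 2 , # 0 , # 1) ∷ (# 7 , # 3 , # 0) ∷ (# 1 , # 4 , # 0) ∷ [])
  ∷ ((# 2 , # 4 , # 2) ∷ (# 8 , # 3 , # 1) ∷ (# 1 , # 3 , # 2) ∷ (# 7 , # 4 , # 1) ∷ [])
  ∷ ((# 3 , # 1 , # 3) ∷ (# 5 , # 2 , # 4) ∷ (# 6 , # 1 , # 4) ∷ (# 4 , # 2 , # 3) ∷ [])
  ∷ ((# 4 , # 1 , # 2) ∷ (# 6 , # 2 , # 1) ∷ (# 3 , # 3 , # 4) ∷ (# 5 , # 4 , # 3) ∷ [])
  ∷ ((# 7 , # 0 , # 2) ∷ (# 1 , # 0 , # 1) ∷ (# 2 , # 3 , # 0) ∷ (# 8 , # 4 , # 0) ∷ [])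
  ∷ ((# 6 , # 1 , # 3) ∷ (# 4 , # 2 , # 4) ∷ (# 5 , # 1 , # 4) ∷ (# 3 , # 2 , # 3) ∷ [])
  ∷ ((# 3 , # 1 , # 2) ∷ (# 5 , # 2 , # 1) ∷ (# 6 , # 3 , # 4) ∷ (# 4 , # 4 , # 3) ∷ [])
  ∷ ((# 0 , # 4 , # 3) ∷ (# 0 , # 2 , # 1) ∷ (# 0 , # 2 , # 3) ∷ (# 0 , # 4 , # 1) ∷ [])
  ∷ ((# 0 , # 0 , # 3) ∷ (# 0 , # 0 , # 1) ∷ (# 0 , # 2 , # 0) ∷ (# 0 , # 4 , # 0) ∷ [])
  ∷ []

basePreimage : Vec (Fin 2 × Fin 5 × Fin 5) 45
basePreimage =
    (# 0 , # 0 , # 1) ∷ (# 1 , # 3 , # 2) ∷ (# 0 , # 3 , # 2) ∷ (# 1 , # 2 , # 4) ∷ (# 1 , # 3 , # 4)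
  ∷ (# 0 , # 4 , # 1) ∷ (# 1 , # 0 , # 3) ∷ (# 1 , # 0 , # 2) ∷ (# 0 , # 0 , # 4) ∷ (# 0 , # 1 , # 3)
  ∷ (# 1 , # 0 , # 4) ∷ (# 0 , # 1 , # 2) ∷ (# 0 , # 0 , # 1) ∷ (# 0 , # 0 , # 1) ∷ (# 0 , # 4 , # 3)
  ∷ (# 1 , # 4 , # 1) ∷ (# 0 , # 4 , # 2) ∷ (# 0 , # 0 , # 1) ∷ (# 1 , # 2 , # 1) ∷ (# 1 , # 3 , # 1)
  ∷ (# 1 , # 1 , # 0) ∷ (# 0 , # 2 , # 0) ∷ (# 0 , # 0 , # 3) ∷ (# 0 , # 3 , # 0) ∷ (# 0 , # 0 , # 2)
  ∷ (# 1 , # 0 , # 1) ∷ (# 1 , # 1 , # 3) ∷ (# 1 , # 1 , # 2) ∷ (# 0 , # 0 , # 1) ∷ (# 0 , # 2 , # 4)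
  ∷ (# 1 , # 1 , # 4) ∷ (# 0 , # 3 , # 4) ∷ (# 0 , # 1 , # 0) ∷ (# 0 , # 0 , # 1) ∷ (# 0 , # 2 , # 1)
  ∷ (# 1 , # 4 , # 0) ∷ (# 0 , # 3 , # 1) ∷ (# 0 , # 4 , # 0) ∷ (# 1 , # 2 , # 0) ∷ (# 1 , # 3 , # 0)
  ∷ (# 0 , # 1 , # 4) ∷ (# 1 , # 4 , # 3) ∷ (# 1 , # 4 , # 2) ∷ (# 0 , # 2 , # 3) ∷ (# 1 , # 2 , # 3)
  ∷ []

residue : ℕ → Fin 45
residue a = fromℕ< (m%n<n a 45)

kindOf : Fin 45 → Kind
kindOf = lookup classKind

multiplierOf : Fin 45 → Multiplier
multiplierOf = lookup classMultiplier

offset : Fin 9 → Fin 5 → Fin 45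
offset b i = residue (proj₁ (lookup (lookup pairBlocks b) i))

coordinateOf : Fin 9 → Fin 5 → Coordinate
coordinateOf b i = proj₂ (lookup (lookup pairBlocks b) i)

pairPreimageOf : Fin 45 → Fin 4 → Fin 9 × Fin 5 × Fin 5
pairPreimageOf c = lookup (lookup pairPreimage c)

pairClass : Fin 9 → Fin 5 → Fin 5 → Fin 45
pairClass b i j = offset b i -ₘ offset b j

formDifference : Fin 9 → Fin 5 → Fin 5 → Form
formDifference b i j = coordinateForm (coordinateOf b i) -ᶠ coordinateForm (coordinateOf b j)

-- The orbit position of ±x, ±y, ±(x−y), ±(x+y) is determined by the signs of the coefficients.
position : Form → Fin 4
position (+ 0       , + 0)       = # 0
position (+ 0       , +[1+ _ ])  = # 2
position (+ 0       , -[1+ _ ])  = # 3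
position (+[1+ _ ]  , + 0)       = # 0
position (-[1+ _ ]  , + 0)       = # 1
position (+[1+ _ ]  , -[1+ _ ])  = # 0
position (-[1+ _ ]  , +[1+ _ ])  = # 1
position (+[1+ _ ]  , +[1+ _ ])  = # 2
position (-[1+ _ ]  , -[1+ _ ])  = # 3

pairPosition : Fin 9 → Fin 5 → Fin 5 → Fin 4
pairPosition b i j = position (formDifference b i j)

PairCertificate : Fin 9 → Fin 5 → Fin 5 → Set
PairCertificate b i j =
  (formDifference b i j ≡ factor (multiplierOf c) ·ᶠ elementForm (kindOf c) (pairPosition b i j)) ×
  (pairPreimageOf c (pairPosition b i j) ≡ (b , i , j))
  where c = pairClass b i j

baseClass : Fin 2 → Fin 5 → Fin 5 → Fin 45
baseClass c i j = residue (lookup (lookup baseBlocks c) i) -ₘ residue (lookup (lookup baseBlocks c) j)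

BaseCertificate : Fin 2 → Fin 5 → Fin 5 → Set
BaseCertificate c i j = lookup basePreimage (baseClass c i j) ≡ (c , i , j)

pairCertificate? : ∀ b i j → Dec (PairCertificate b i j)
pairCertificate? b i j =
  ≡-dec ℤ._≟_ ℤ._≟_ _ _ ×-dec ≡-dec Fin._≟_ (≡-dec Fin._≟_ Fin._≟_) _ _

baseCertificate? : ∀ c i j → Dec (BaseCertificate c i j)
baseCertificate? c i j = ≡-dec Fin._≟_ (≡-dec Fin._≟_ Fin._≟_) _ _

abstract
  pair-certificates : ∀ b i j → i ≡ j ⊎ PairCertificate b i j
  pair-certificates = toWitness {a? = Finₚ.all? λ b → Finₚ.all? λ i → Finₚ.all? λ j →
                                       i Fin.≟ j ⊎-dec pairCertificate? b i j} _

  base-certificates : ∀ c i j → i ≡ j ⊎ BaseCertificate c i j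
  base-certificates = toWitness {a? = Finₚ.all? λ c → Finₚ.all? λ i → Finₚ.all? λ j →
                                       i Fin.≟ j ⊎-dec baseCertificate? c i j} _

pair-certificate : ∀ b {i j} → i ≢ j → PairCertificate b i j
pair-certificate b {i} {j} i≢j = [ flip contradiction i≢j , id ]′ (pair-certificates b i j)

base-certificate : ∀ c {i j} → i ≢ j → BaseCertificate c i j
base-certificate c {i} {j} i≢j = [ flip contradiction i≢j , id ]′ (base-certificates c i j)

module Construction (w : ℕ) (coprime-45 : Coprime 45 (suc w)) (coprime-2 : Coprime 2 (suc w))
                    (ps : PS (suc w)) (|pairs|*4≡w : length (PS.pairs ps) ℕ.* 4 ≡ w) where

  open import Data.Integer using (_*_; _-_)

  private
    v = suc w
    P = Fin v × Fin v
    S = PS.pairs ps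

  open ChineseRemainder 45 v coprime-45

  private
    orbits-partition : ∀ κ → All Unique (map (orbit κ) S) × AllPairs Disjoint (map (orbit κ) S)
    orbits-partition κ = Unique-concat⁻ (map (orbit κ) S) (orbits-Unique ps |pairs|*4≡w κ)

  orbit-Unique : ∀ κ {p} → p ∈ S → Unique (orbit κ p)
  orbit-Unique κ p∈ = All.lookup (proj₁ (orbits-partition κ)) (∈-map⁺ (orbit κ) p∈)

  orbits-disjoint : ∀ κ {p p'} → p ∈ S → p' ∈ S → p ≢ p' → Disjoint (orbit κ p) (orbit κ p')
  orbits-disjoint κ = AllPairs-∈ Disjointₚ.sym (AllPairsₚ.map⁻ (proj₂ (orbits-partition κ)))

  pairs-Unique : Unique S
  pairs-Unique = AllPairs.map
    (λ disjoint p≡p' → disjoint (here refl , subst (λ q → _ ∈ orbit plain q) p≡p' (here refl)))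
    (AllPairsₚ.map⁻ (proj₂ (orbits-partition plain)))

  element∈orbit : ∀ κ (p : P) k → element κ p k ∈ orbit κ p
  element∈orbit κ p k = subst (element κ p k ∈_) (orbit-tabulate κ p) (∈-tabulate⁺ {f = element κ p} k)

  element-injective : ∀ κ {p k k'} → p ∈ S → element κ p k ≡ element κ p k' → k ≡ k'
  element-injective κ {p} p∈ =
    Unique-tabulate⇒injective {f = element κ p} (subst Unique (sym (orbit-tabulate κ p)) (orbit-Unique κ p∈))

  element-nonzero : ∀ κ {p} k → p ∈ S → element κ p k ≢ zero
  element-nonzero κ {p} k p∈ eq =
    orbits-cover ps κ (element κ p k)
      (∈-concat⁺′ (element∈orbit κ p k) (∈-map⁺ (orbit κ) p∈)) (cong toℕ eq)

  factor-coprime : ∀ μ → Coprime (factor μ) v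
  factor-coprime once  = 1-coprimeTo v
  factor-coprime twice = coprime-2

  coordinateDifference : P → Fin 9 → Fin 5 → Fin 5 → ℤ
  coordinateDifference p b i j = toℤ (coordinate (coordinateOf b i) p) - toℤ (coordinate (coordinateOf b j) p)

  scaledElement : Fin 45 → P → Fin 4 → ℤ
  scaledElement c p k = + factor (multiplierOf c) * toℤ (element (kindOf c) p k)

  pair-difference : ∀ p b {i j} → i ≢ j →
    coordinateDifference p b i j ≡ scaledElement (pairClass b i j) p (pairPosition b i j) mod v
  pair-difference p b {i} {j} i≢j = begin
    coordinateDifference p b i j
      ≈⟨ -‿cong-mod (coordinate-form (coordinateOf b i) p) (coordinate-form (coordinateOf b j) p) ⟩
    eval (coordinateForm (coordinateOf b i)) X - eval (coordinateForm (coordinateOf b j)) X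
      ≡⟨ eval-subᶠ (coordinateForm (coordinateOf b i)) (coordinateForm (coordinateOf b j)) X ⟨
    eval (formDifference b i j) X
      ≡⟨ cong (λ f → eval f X) (proj₁ (pair-certificate b i≢j)) ⟩
    eval (factor μ ·ᶠ elementForm κ k) X
      ≡⟨ eval-scaleᶠ (factor μ) (elementForm κ k) X ⟩
    + factor μ * eval (elementForm κ k) X
      ≈⟨ *-congˡ-mod (+ factor μ) (element-form κ p k) ⟨
    + factor μ * toℤ (element κ p k)
      ∎
    where
    open ≡-mod-Reasoning v
    X = toℤ² p
    c = pairClass b i j
    μ = multiplierOf c
    κ = kindOf c
    k = pairPosition b i j

  Tag : Set
  Tag = Fin 2 ⊎ P × Fin 9

  offsetOfTag : Tag → Fin 5 → Fin 45
  offsetOfTag (inj₁ c)       i = residue (lookup (lookup baseBlocks c) i)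
  offsetOfTag (inj₂ (_ , b)) i = offset b i

  coordinateOfTag : Tag → Fin 5 → Fin v
  coordinateOfTag (inj₁ _)       _ = zero
  coordinateOfTag (inj₂ (p , b)) i = coordinate (coordinateOf b i) p

  point : Tag → Fin 5 → Fin (45 ℕ.* v)
  point t i = crt (offsetOfTag t i) (coordinateOfTag t i)

  open Configurations point

  tag-difference : ∀ {t t' i j i' j'} → Δ t i j ≡ Δ t' i' j' →
    (offsetOfTag t i -ₘ offsetOfTag t j ≡ offsetOfTag t' i' -ₘ offsetOfTag t' j') ×
    (toℤ (coordinateOfTag t i) - toℤ (coordinateOfTag t j)
       ≡ toℤ (coordinateOfTag t' i') - toℤ (coordinateOfTag t' j') mod v)
  tag-difference {t} {t'} {i} {j} {i'} {j'} =
    crt-difference {offsetOfTag t i} {coordinateOfTag t i} {offsetOfTag t j} {coordinateOfTag t j}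
                   {offsetOfTag t' i'} {coordinateOfTag t' i'} {offsetOfTag t' j'} {coordinateOfTag t' j'}

  tags : List Tag
  tags = map inj₁ (allFin 2) ++ map inj₂ (cartesianProduct S (allFin 9))

  base-differences-injective : ∀ {c c' i j i' j'} → i ≢ j → i' ≢ j' → Δ (inj₁ c) i j ≡ Δ (inj₁ c') i' j' →
              (c , i , j) ≡ (c' , i' , j')
  base-differences-injective {c} {c'} {i} {j} {i'} {j'} i≢j i'≢j' eq = begin
    (c , i , j)                               ≡⟨ base-certificate c i≢j ⟨
    lookup basePreimage (baseClass c i j)     ≡⟨ cong (lookup basePreimage) (proj₁ (tag-difference {inj₁ c} {inj₁ c'} eq)) ⟩
    lookup basePreimage (baseClass c' i' j')  ≡⟨ base-certificate c' i'≢j' ⟩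
    (c' , i' , j')                            ∎
    where open ≡-Reasoning

  equal-pair-differences : ∀ {p p' b b' i j i' j'} → i ≢ j → i' ≢ j' →
    Δ (inj₂ (p , b)) i j ≡ Δ (inj₂ (p' , b')) i' j' →
    let κ = kindOf (pairClass b i j) in
    pairClass b i j ≡ pairClass b' i' j' ×
    element κ p (pairPosition b i j) ≡ element κ p' (pairPosition b' i' j')
  equal-pair-differences {p} {p'} {b} {b'} {i} {j} {i'} {j'} i≢j i'≢j' eq =
    c≡c' , toℤ-injective-mod (*-cancelˡ-mod (factor-coprime (multiplierOf c)) (begin
      scaledElement c p (pairPosition b i j)      ≈⟨ pair-difference p b i≢j ⟨
      coordinateDifference p b i j                ≈⟨ proj₂ (tag-difference {inj₂ (p , b)} {inj₂ (p' , b')} eq) ⟩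
      coordinateDifference p' b' i' j'            ≈⟨ pair-difference′ ⟩
      scaledElement c p' (pairPosition b' i' j')  ∎))
    where
    open ≡-mod-Reasoning v
    c = pairClass b i j
    c≡c' = proj₁ (tag-difference {inj₂ (p , b)} {inj₂ (p' , b')} eq)
    pair-difference′ : coordinateDifference p' b' i' j' ≡ scaledElement c p' (pairPosition b' i' j') mod v
    pair-difference′ =
      subst (λ c → coordinateDifference p' b' i' j' ≡ scaledElement c p' (pairPosition b' i' j') mod v)
            (sym c≡c') (pair-difference p' b' i'≢j')

  base≢pair-difference : ∀ {c p b i j i' j'} → p ∈ S → i' ≢ j' → Δ (inj₁ c) i j ≢ Δ (inj₂ (p , b)) i' j'
  base≢pair-difference {c} {p} {b} {i} {j} {i'} {j'} p∈ i'≢j' eq =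
    element-nonzero κ k p∈ (toℤ-injective-mod (*-cancelˡ-mod (factor-coprime (multiplierOf c')) (begin
      scaledElement c' p k               ≈⟨ pair-difference p b i'≢j' ⟨
      coordinateDifference p b i' j'     ≈⟨ proj₂ (tag-difference {inj₁ c} {inj₂ (p , b)} eq) ⟨
      0ℤ - 0ℤ                            ≡⟨ identity (+ factor (multiplierOf c')) ⟩
      + factor (multiplierOf c') * 0ℤ    ∎)))
    where
    open ≡-mod-Reasoning v
    c' = pairClass b i' j'
    κ = kindOf c'
    k = pairPosition b i' j'
    identity : ∀ m → 0ℤ - 0ℤ ≡ m * 0ℤ
    identity = solve-∀

  pair∈tags⇒pair∈S : ∀ {p b} → inj₂ (p , b) ∈ tags → p ∈ S
  pair∈tags⇒pair∈S t∈ with ∈-++⁻ (map inj₁ (allFin 2)) t∈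
  ... | inj₁ t∈base with ∈-map⁻ inj₁ t∈base
  ...   | _ , _ , ()
  pair∈tags⇒pair∈S t∈ | inj₂ t∈pairs with ∈-map⁻ inj₂ t∈pairs
  ...   | _ , pb∈ , refl = proj₁ (∈-cartesianProduct⁻ S (allFin 9) pb∈)

  pair-differences-injective : ∀ {p p' b b' i j i' j'} → p ∈ S → p' ∈ S → i ≢ j → i' ≢ j' →
    Δ (inj₂ (p , b)) i j ≡ Δ (inj₂ (p' , b')) i' j' → (p , b , i , j) ≡ (p' , b' , i' , j')
  pair-differences-injective {p} {p'} {b} {b'} {i} {j} {i'} {j'} p∈ p'∈ i≢j i'≢j' eq =
    by-cases (≡-dec Fin._≟_ Fin._≟_ p p')
    where
    c≡c' = proj₁ (equal-pair-differences {p} {p'} {b} {b'} i≢j i'≢j' eq)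
    e≡e' = proj₂ (equal-pair-differences {p} {p'} {b} {b'} i≢j i'≢j' eq)
    κ = kindOf (pairClass b i j)
    by-cases : Dec (p ≡ p') → (p , b , i , j) ≡ (p' , b' , i' , j')
    by-cases (yes p≡p') = cong₂ _,_ p≡p' (begin
      (b , i , j)                                                ≡⟨ proj₂ (pair-certificate b i≢j) ⟨
      pairPreimageOf (pairClass b i j) (pairPosition b i j)      ≡⟨ cong₂ pairPreimageOf c≡c' k≡k' ⟩
      pairPreimageOf (pairClass b' i' j') (pairPosition b' i' j') ≡⟨ proj₂ (pair-certificate b' i'≢j') ⟩
      (b' , i' , j')                                             ∎)
      where
      open ≡-Reasoning
      k≡k' = element-injective κ p∈ (subst (λ q → element κ p _ ≡ element κ q _) (sym p≡p') e≡e')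
    by-cases (no p≢p') = ⊥-elim (orbits-disjoint κ p∈ p'∈ p≢p'
      (element∈orbit κ p _ , subst (_∈ orbit κ p') (sym e≡e') (element∈orbit κ p' _)))

  differences-injective : DifferencesInjectiveOn tags
  differences-injective {inj₁ c} {inj₁ c'} _ _ i≢j i'≢j' eq =
    cong (λ (c , i , j) → inj₁ c , i , j) (base-differences-injective {c} {c'} i≢j i'≢j' eq)
  differences-injective {inj₁ c} {inj₂ (p , b)} {i = i} {j} {i'} {j'} _ t'∈ _ i'≢j' eq =
    ⊥-elim (base≢pair-difference {c} {p} {b} {i} {j} {i'} {j'} (pair∈tags⇒pair∈S t'∈) i'≢j' eq)
  differences-injective {inj₂ (p , b)} {inj₁ c} {i = i} {j} {i'} {j'} t∈ _ i≢j _ eq =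
    ⊥-elim (base≢pair-difference {c} {p} {b} {i'} {j'} {i} {j} (pair∈tags⇒pair∈S t∈) i≢j (sym eq))
  differences-injective {inj₂ (p , b)} {inj₂ (p' , b')} t∈ t'∈ i≢j i'≢j' eq =
    cong (λ (p , b , i , j) → inj₂ (p , b) , i , j)
      (pair-differences-injective {p} {p'} {b} {b'} (pair∈tags⇒pair∈S t∈) (pair∈tags⇒pair∈S t'∈)
                                  i≢j i'≢j' eq)

  tags-Unique : Unique tags
  tags-Unique = Uniqueₚ.++⁺
    (Uniqueₚ.map⁺ Sumₚ.inj₁-injective (Uniqueₚ.allFin⁺ 2))
    (Uniqueₚ.map⁺ Sumₚ.inj₂-injective (Uniqueₚ.cartesianProduct⁺ pairs-Unique (Uniqueₚ.allFin⁺ 9)))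
    bases-disjoint-from-pairs
    where
    bases-disjoint-from-pairs : Disjoint (map inj₁ (allFin 2)) (map inj₂ (cartesianProduct S (allFin 9)))
    bases-disjoint-from-pairs (t∈base , t∈pairs) with ∈-map⁻ inj₁ t∈base | ∈-map⁻ inj₂ t∈pairs
    ... | _ , _ , refl | _ , _ , ()

  length-tags : length tags ≡ 2 ℕ.+ length S ℕ.* 9
  length-tags = begin
    length tags                             ≡⟨ Listₚ.length-++ (map inj₁ (allFin 2)) {map inj₂ S×9} ⟩
    2 ℕ.+ length (map inj₂ S×9)             ≡⟨ cong (2 ℕ.+_) (Listₚ.length-map inj₂ S×9) ⟩
    2 ℕ.+ length S×9                        ≡⟨ cong (2 ℕ.+_) (length-cartesianProduct S (allFin 9)) ⟩
    2 ℕ.+ length S ℕ.* length (allFin 9)    ≡⟨ cong (λ n → 2 ℕ.+ length S ℕ.* n) (Listₚ.length-tabulate {n = 9} id) ⟩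
    2 ℕ.+ length S ℕ.* 9                    ∎
    where
    open ≡-Reasoning
    S×9 = cartesianProduct S (allFin 9)

  maximum-OOC : Σ (OOC (45 ℕ.* v) 5) IsMaximum
  maximum-OOC = C , length-missing≤ C (begin
    45 ℕ.* suc w                              ≡⟨ cong (λ n → 45 ℕ.* suc n) |pairs|*4≡w ⟨
    45 ℕ.* suc (length S ℕ.* 4)               ≡⟨ count (length S) ⟩
    (2 ℕ.+ length S ℕ.* 9) ℕ.* 20 ℕ.+ 5       ≡⟨ cong (λ n → n ℕ.* 20 ℕ.+ 5) length-tags ⟨
    length tags ℕ.* 20 ℕ.+ 5                  ≡⟨ cong (ℕ._+ 5) |differences|≡ ⟨
    length (allDiffs (OOC.blocks C)) ℕ.+ 5    ≤⟨ ℕₚ.+-monoʳ-≤ (length (allDiffs (OOC.blocks C))) (ℕₚ.m≤m+n 5 15) ⟩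
    length (allDiffs (OOC.blocks C)) ℕ.+ 20   ∎)
    where
    open ℕₚ.≤-Reasoning
    ooc = configurations⇒OOC differences-injective tags-Unique {zero} {suc zero} (λ ())
    C = proj₁ ooc
    |differences|≡ : length (allDiffs (OOC.blocks C)) ≡ length tags ℕ.* (5 ℕ.* 4)
    |differences|≡ = proj₂ ooc
    count : ∀ s → 45 ℕ.* suc (s ℕ.* 4) ≡ (2 ℕ.+ s ℕ.* 9) ℕ.* 20 ℕ.+ 5
    count = ℕ-solve-∀

open import Data.Nat using (_*_; _%_; _/_)

pred≡quotient*4 : ∀ w → suc w % 4 ≡ 1 → w ≡ suc w / 4 * 4
pred≡quotient*4 w 1+w%4≡1 =
  ℕₚ.suc-injective (trans (m≡m%n+[m/n]*n (suc w) 4) (cong (ℕ._+ suc w / 4 * 4) 1+w%4≡1))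

≡1-mod-4⇒coprime-2 : ∀ {w} → suc w % 4 ≡ 1 → Coprime 2 (suc w)
≡1-mod-4⇒coprime-2 {w} 1+w%4≡1 {d} (d∣2 , d∣1+w) =
  ∣1⇒≡1 (∣m+n∣m⇒∣n (subst (d ∣_) (ℕₚ.+-comm 1 w) d∣1+w) (∣-trans d∣2 2∣w))
  where
  2∣w : 2 ∣ w
  2∣w = subst (2 ∣_) (sym (pred≡quotient*4 w 1+w%4≡1)) (∣-trans (divides 2 refl) (n∣m*n (suc w / 4)))

length-PS-pairs : ∀ {w} → suc w % 4 ≡ 1 → (ps : PS (suc w)) → length (PS.pairs ps) * 4 ≡ w
length-PS-pairs {w} 1+w%4≡1 ps = begin
  length (PS.pairs ps) * 4   ≡⟨ cong (_* 4) (PS.size ps) ⟩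
  w / 4 * 4                  ≡⟨ cong (λ n → n / 4 * 4) w≡t*4 ⟩
  t * 4 / 4 * 4              ≡⟨ cong (_* 4) (m*n/n≡m t 4) ⟩
  t * 4                      ≡⟨ w≡t*4 ⟨
  w                          ∎
  where
  open ≡-Reasoning
  t = suc w / 4
  w≡t*4 = pred≡quotient*4 w 1+w%4≡1

theorem6p2 : (v : ℕ) → v % 4 ≡ 1 → gcd v 45 ≡ 1 → PS v →
    Σ (OOC (45 * v) 5) IsMaximum
theorem6p2 zero    () _ _
theorem6p2 (suc w) v%4≡1 gcd≡1 ps =
  Construction.maximum-OOC w (Coprimality.sym (gcd≡1⇒coprime gcd≡1)) (≡1-mod-4⇒coprime-2 v%4≡1)
                           ps (length-PS-pairs v%4≡1 ps)
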